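{- For binary strings $s,t\in\{0,1\}^n$, let $\mathrm{LCS}(s,t)$ denote the length of a longest common subsequence of $s$ and $t$. Let $s$ and $t$ be drawn independently and uniformly at random from $\{0,1\}^n$. Then \[ \mathbb{E}\big[\mathrm{LCS}(s,t)\big] \ge 0.66666\,n - O\big(\sqrt{n\log n}\big) \] as $n\to\infty$.
   Context: A string $u=u_1\cdots u_m$ is a subsequence of $t=t_1\cdots t_n$ if there are indices $i_1<\dots<i_m$ with $u_j=t_{i_j}$ for all $j$. A longest common subsequence of $s$ and $t$ is a longest string that is a subsequence of both. -}

module Defs where

open import Data.Bool using (Bool; true; false)
open import Data.Bool.Properties using () renaming (_≟_ to _≟ᴮ_)
open import Data.List using (List; []; _∷_; map; _++_; length; filter)
open import Data.Nat.ListAction using (sum)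
open import Data.Nat using (ℕ; zero; suc; _⊔_; _+_; _*_; _^_; _∸_)
open import Data.List.Relation.Binary.Sublist.Propositional using (_⊆_)
open import Data.List.Relation.Binary.Sublist.DecPropositional _≟ᴮ_ using (_⊆?_)

-- Binary strings are lists of booleans (false = 0, true = 1).
BinStr : Set
BinStr = List Bool

IsSubseq : BinStr → BinStr → Set
IsSubseq u t = u ⊆ t

subseqs : BinStr → List BinStr
subseqs []       = [] ∷ []
subseqs (x ∷ xs) = map (x ∷_) (subseqs xs) ++ subseqs xs

maximum : List ℕ → ℕ
maximum []       = 0
maximum (x ∷ xs) = x ⊔ maximum xs

LCS : BinStr → BinStr → ℕ
LCS s t = maximum (map length (filter (λ u → u ⊆? t) (subseqs s)))

allStrings : ℕ → List BinStr
allStrings zero    = [] ∷ []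
allStrings (suc n) = map (false ∷_) (allStrings n) ++ map (true ∷_) (allStrings n)

-- Total of LCS(s,t) over all pairs (s,t) ∈ {0,1}^n × {0,1}^n.
-- E[LCS(s,t)] for independent uniform s,t equals  totalLCS n / 4^n.
totalLCS : ℕ → ℕ
totalLCS n = sum (map (λ s → sum (map (λ t → LCS s t) (allStrings n))) (allStrings n))

-- Deficit scaled by 10^5 · 4^n:
--   deficit n = max(0, 66666·n·4^n − 10^5·totalLCS n)
--             = 10^5 · 4^n · max(0, 0.66666·n − E[LCS])
deficit : ℕ → ℕ
deficit n = 66666 * n * 4 ^ n ∸ 100000 * totalLCS n

{-# OPTIONS --safe #-}
-- Concatenating a common subsequence of (a, c) with one of (b, d) gives a common
-- subsequence of (a ++ b, c ++ d), so n ↦ E[LCS] over strings of length n is superadditive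
-- and hence E[LCS] ≥ (n / 7 − 1) · E[LCS over length 7].  Evaluating all 4^7 pairs of
-- length 7 gives E[LCS over length 7] ≥ 77356 / 4^7 > 7 · 0.66666, so the deficit
-- 0.66666 n − E[LCS] is in fact bounded by a constant.
module Submission where

open import Defs
open import Data.Nat using (ℕ; _≤_; _*_; _^_; zero; suc; _+_; _<_; _≤ᵇ_; _≤?_; z≤n; NonZero; >-nonZero⁻¹)
open import Data.Nat.Logarithm using (⌊log₂_⌋; ⌊log₂⌋-mono-≤)
open import Data.Product using (∃-syntax; _×_; _,_)

open import Data.Bool using (true; false; if_then_else_)
open import Data.Bool.Properties using () renaming (_≟_ to _≟ᴮ_)
open import Data.List using (List; []; _∷_; map; _++_; length; filter)
open import Data.List.Properties using (length-++; length-map; map-++; map-∘; map-cong)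
open import Data.List.Membership.Propositional using (_∈_)
open import Data.List.Membership.Propositional.Properties
  using (∈-++⁺ˡ; ∈-++⁺ʳ; ∈-++⁻; ∈-map⁺; ∈-map⁻; ∈-filter⁺; ∈-filter⁻)
open import Data.List.Relation.Unary.Any using (here; there)
open import Data.List.Relation.Binary.Sublist.Propositional using (_⊆_; []; _∷_; _∷ʳ_; minimum)
open import Data.List.Relation.Binary.Sublist.Propositional.Properties using (++⁺)
open import Data.List.Relation.Binary.Sublist.DecPropositional _≟ᴮ_ using (_⊆?_)
open import Data.Nat.Induction using (<-rec)
open import Data.Nat.ListAction using (sum)
open import Data.Nat.ListAction.Properties using (sum-++)
open import Data.Nat.Properties
open import Algebra.Properties.CommutativeSemigroup +-commutativeSemigroup
  using () renaming (interchange to +-interchange)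
open import Data.Nat.Tactic.RingSolver using (solve-∀)
open import Data.Sum using (_⊎_; inj₁; inj₂)
open import Relation.Nullary using (does; yes; no)
open import Relation.Binary.PropositionalEquality

∈-subseqs⁺ : ∀ {u s : BinStr} → u ⊆ s → u ∈ subseqs s
∈-subseqs⁺ []                       = here refl
∈-subseqs⁺ {s = x ∷ s} (.x ∷ʳ u⊆s) = ∈-++⁺ʳ (map (x ∷_) (subseqs s)) (∈-subseqs⁺ u⊆s)
∈-subseqs⁺ (refl ∷ u⊆s)             = ∈-++⁺ˡ (∈-map⁺ _ (∈-subseqs⁺ u⊆s))

∈-subseqs⁻ : ∀ {u} s → u ∈ subseqs s → u ⊆ s
∈-subseqs⁻ []       (here refl) = []
∈-subseqs⁻ (x ∷ s) u∈ with ∈-++⁻ (map (x ∷_) (subseqs s)) u∈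
... | inj₂ u∈s = x ∷ʳ ∈-subseqs⁻ s u∈s
... | inj₁ u∈xs with ∈-map⁻ (x ∷_) u∈xs
...   | _ , v∈s , refl = refl ∷ ∈-subseqs⁻ s v∈s

≤-maximum : ∀ {n} ns → n ∈ ns → n ≤ maximum ns
≤-maximum (m ∷ ns) (here refl) = m≤m⊔n m _
≤-maximum (m ∷ ns) (there n∈)  = ≤-trans (≤-maximum ns n∈) (m≤n⊔m m _)

maximum≡0⊎maximum∈ : ∀ ns → maximum ns ≡ 0 ⊎ maximum ns ∈ ns
maximum≡0⊎maximum∈ []       = inj₁ refl
maximum≡0⊎maximum∈ (m ∷ ns) with ⊔-sel m (maximum ns)
... | inj₁ ≡m = inj₂ (here ≡m)
... | inj₂ ≡max with maximum≡0⊎maximum∈ ns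
...   | inj₁ max≡0 = inj₁ (trans ≡max max≡0)
...   | inj₂ max∈  = inj₂ (there (subst (_∈ ns) (sym ≡max) max∈))

Common : BinStr → BinStr → BinStr → Set
Common u s t = u ⊆ s × u ⊆ t

LCS-witness : ∀ s t → ∃[ u ] Common u s t × length u ≡ LCS s t
LCS-witness s t with maximum≡0⊎maximum∈ (map length (filter (_⊆? t) (subseqs s)))
... | inj₁ LCS≡0 = [] , (minimum s , minimum t) , sym LCS≡0
... | inj₂ LCS∈ with ∈-map⁻ length LCS∈
...   | u , u∈ , LCS≡ with ∈-filter⁻ (_⊆? t) {xs = subseqs s} u∈
...     | u∈subseqs , u⊆t = u , (∈-subseqs⁻ s u∈subseqs , u⊆t) , sym LCS≡

length≤LCS : ∀ {u s t} → Common u s t → length u ≤ LCS s t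
length≤LCS {t = t} (u⊆s , u⊆t) =
  ≤-maximum _ (∈-map⁺ length (∈-filter⁺ (_⊆? t) (∈-subseqs⁺ u⊆s) u⊆t))

LCS-++-superadditive : ∀ s₁ s₂ t₁ t₂ → LCS s₁ t₁ + LCS s₂ t₂ ≤ LCS (s₁ ++ s₂) (t₁ ++ t₂)
LCS-++-superadditive s₁ s₂ t₁ t₂
  with u₁ , (u₁⊆s₁ , u₁⊆t₁) , |u₁|≡ ← LCS-witness s₁ t₁
     | u₂ , (u₂⊆s₂ , u₂⊆t₂) , |u₂|≡ ← LCS-witness s₂ t₂
  = begin
    LCS s₁ t₁ + LCS s₂ t₂        ≡⟨ cong₂ _+_ |u₁|≡ |u₂|≡ ⟨
    length u₁ + length u₂        ≡⟨ length-++ u₁ ⟨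
    length (u₁ ++ u₂)            ≤⟨ length≤LCS (++⁺ u₁⊆s₁ u₂⊆s₂ , ++⁺ u₁⊆t₁ u₂⊆t₂) ⟩
    LCS (s₁ ++ s₂) (t₁ ++ t₂)    ∎
  where open ≤-Reasoning

private variable
  A B : Set

∑ : List A → (A → ℕ) → ℕ
∑ xs f = sum (map f xs)

syntax ∑ xs (λ x → e) = ∑[ x ∈ xs ] e

∑-++ : ∀ (xs ys : List A) f → ∑ (xs ++ ys) f ≡ ∑ xs f + ∑ ys f
∑-++ xs ys f = trans (cong sum (map-++ f xs ys)) (sum-++ (map f xs) (map f ys))

∑-map : ∀ (g : A → B) xs f → ∑ (map g xs) f ≡ ∑[ x ∈ xs ] f (g x)
∑-map g xs f = cong sum (sym (map-∘ xs))

∑-cong : ∀ {f g : A → ℕ} → (∀ x → f x ≡ g x) → ∀ xs → ∑ xs f ≡ ∑ xs g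
∑-cong f≗g xs = cong sum (map-cong f≗g xs)

∑-mono-≤ : ∀ {f g : A → ℕ} → (∀ x → f x ≤ g x) → ∀ xs → ∑ xs f ≤ ∑ xs g
∑-mono-≤ f≤g []       = z≤n
∑-mono-≤ f≤g (x ∷ xs) = +-mono-≤ (f≤g x) (∑-mono-≤ f≤g xs)

∑-const : ∀ (xs : List A) c → ∑[ _ ∈ xs ] c ≡ length xs * c
∑-const []       c = refl
∑-const (x ∷ xs) c = cong (c +_) (∑-const xs c)

∑-distrib-+ : ∀ xs (f g : A → ℕ) → ∑[ x ∈ xs ] (f x + g x) ≡ ∑ xs f + ∑ xs g
∑-distrib-+ []       f g = refl
∑-distrib-+ (x ∷ xs) f g = trans (cong (f x + g x +_) (∑-distrib-+ xs f g))
                                 (+-interchange (f x) (g x) (∑ xs f) (∑ xs g))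

∑-distribˡ-* : ∀ xs c (f : A → ℕ) → ∑[ x ∈ xs ] (c * f x) ≡ c * ∑ xs f
∑-distribˡ-* []       c f = sym (*-zeroʳ c)
∑-distribˡ-* (x ∷ xs) c f = trans (cong (c * f x +_) (∑-distribˡ-* xs c f))
                                  (sym (*-distribˡ-+ c (f x) (∑ xs f)))

∑-comm : ∀ xs ys (f : A → B → ℕ) →
         ∑[ x ∈ xs ] ∑[ y ∈ ys ] f x y ≡ ∑[ y ∈ ys ] ∑[ x ∈ xs ] f x y
∑-comm []       ys f = trans (sym (*-zeroʳ (length ys))) (sym (∑-const ys 0))
∑-comm (x ∷ xs) ys f = trans (cong (∑ ys (f x) +_) (∑-comm xs ys f))
                             (sym (∑-distrib-+ ys (f x) (λ y → ∑[ x ∈ xs ] f x y)))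

^-distribʳ-* : ∀ m n o → (m * n) ^ o ≡ m ^ o * n ^ o
^-distribʳ-* m n zero    = refl
^-distribʳ-* m n (suc o) = trans (cong ((m * n) *_) (^-distribʳ-* m n o))
                                 ([m*n]*[o*p]≡[m*o]*[n*p] m n (m ^ o) (n ^ o))

length-allStrings : ∀ n → length (allStrings n) ≡ 2 ^ n
length-allStrings zero    = refl
length-allStrings (suc n) = begin
  length (map (false ∷_) (allStrings n) ++ map (true ∷_) (allStrings n))
    ≡⟨ length-++ (map (false ∷_) (allStrings n)) ⟩
  length (map (false ∷_) (allStrings n)) + length (map (true ∷_) (allStrings n))
    ≡⟨ cong₂ _+_ (length-map (false ∷_) (allStrings n)) (length-map (true ∷_) (allStrings n)) ⟩
  length (allStrings n) + length (allStrings n)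
    ≡⟨ cong₂ _+_ (length-allStrings n) (trans (length-allStrings n) (sym (+-identityʳ _))) ⟩
  2 ^ suc n ∎
  where open ≡-Reasoning

∑-allStrings-const : ∀ n c → ∑[ _ ∈ allStrings n ] c ≡ 2 ^ n * c
∑-allStrings-const n c = trans (∑-const (allStrings n) c) (cong (_* c) (length-allStrings n))

∑-allStrings-suc : ∀ n f →
  ∑ (allStrings (suc n)) f ≡ ∑[ s ∈ allStrings n ] f (false ∷ s) + ∑[ s ∈ allStrings n ] f (true ∷ s)
∑-allStrings-suc n f =
  trans (∑-++ (map (false ∷_) (allStrings n)) (map (true ∷_) (allStrings n)) f)
        (cong₂ _+_ (∑-map (false ∷_) (allStrings n) f) (∑-map (true ∷_) (allStrings n) f))

∑-allStrings-+ : ∀ k n f →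
  ∑ (allStrings (k + n)) f ≡ ∑[ a ∈ allStrings k ] ∑[ b ∈ allStrings n ] f (a ++ b)
∑-allStrings-+ zero    n f = sym (+-identityʳ _)
∑-allStrings-+ (suc k) n f = begin
  ∑ (allStrings (suc k + n)) f
    ≡⟨ ∑-allStrings-suc (k + n) f ⟩
  ∑[ s ∈ allStrings (k + n) ] f (false ∷ s) + ∑[ s ∈ allStrings (k + n) ] f (true ∷ s)
    ≡⟨ cong₂ _+_ (∑-allStrings-+ k n (λ s → f (false ∷ s))) (∑-allStrings-+ k n (λ s → f (true ∷ s))) ⟩
  ∑[ a ∈ allStrings k ] F (false ∷ a) + ∑[ a ∈ allStrings k ] F (true ∷ a)
    ≡⟨ ∑-allStrings-suc k F ⟨
  ∑ (allStrings (suc k)) F ∎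
  where
  open ≡-Reasoning
  F : BinStr → ℕ
  F a = ∑[ b ∈ allStrings n ] f (a ++ b)

∑² : ℕ → (BinStr → BinStr → ℕ) → ℕ
∑² n f = ∑[ s ∈ allStrings n ] ∑[ t ∈ allStrings n ] f s t

∑²-const : ∀ n c → ∑² n (λ _ _ → c) ≡ 4 ^ n * c
∑²-const n c = begin
  ∑² n (λ _ _ → c)                   ≡⟨ ∑-cong (λ _ → ∑-allStrings-const n c) (allStrings n) ⟩
  ∑[ _ ∈ allStrings n ] (2 ^ n * c)  ≡⟨ ∑-allStrings-const n (2 ^ n * c) ⟩
  2 ^ n * (2 ^ n * c)                ≡⟨ *-assoc (2 ^ n) (2 ^ n) c ⟨
  2 ^ n * 2 ^ n * c                  ≡⟨ cong (_* c) (^-distribʳ-* 2 2 n) ⟨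
  4 ^ n * c                          ∎
  where open ≡-Reasoning

∑²-distrib-+ : ∀ n f g → ∑² n (λ s t → f s t + g s t) ≡ ∑² n f + ∑² n g
∑²-distrib-+ n f g =
  trans (∑-cong (λ s → ∑-distrib-+ (allStrings n) (f s) (g s)) (allStrings n))
        (∑-distrib-+ (allStrings n) (λ s → ∑ (allStrings n) (f s)) (λ s → ∑ (allStrings n) (g s)))

∑²-distribˡ-* : ∀ n c f → ∑² n (λ s t → c * f s t) ≡ c * ∑² n f
∑²-distribˡ-* n c f =
  trans (∑-cong (λ s → ∑-distribˡ-* (allStrings n) c (f s)) (allStrings n))
        (∑-distribˡ-* (allStrings n) c (λ s → ∑ (allStrings n) (f s)))

∑²-mono-≤ : ∀ n {f g} → (∀ s t → f s t ≤ g s t) → ∑² n f ≤ ∑² n g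
∑²-mono-≤ n f≤g = ∑-mono-≤ (λ s → ∑-mono-≤ (f≤g s) (allStrings n)) (allStrings n)

∑²-+ : ∀ k n f → ∑² (k + n) f ≡ ∑² k (λ a c → ∑² n (λ b d → f (a ++ b) (c ++ d)))
∑²-+ k n f = begin
  ∑² (k + n) f
    ≡⟨ ∑-allStrings-+ k n _ ⟩
  ∑[ a ∈ allStrings k ] ∑[ b ∈ allStrings n ] ∑[ t ∈ allStrings (k + n) ] f (a ++ b) t
    ≡⟨ ∑-cong (λ a → ∑-cong (λ b → ∑-allStrings-+ k n (f (a ++ b))) (allStrings n)) (allStrings k) ⟩
  ∑[ a ∈ allStrings k ] ∑[ b ∈ allStrings n ] ∑[ c ∈ allStrings k ] ∑[ d ∈ allStrings n ] f (a ++ b) (c ++ d)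
    ≡⟨ ∑-cong (λ a → ∑-comm (allStrings n) (allStrings k) _) (allStrings k) ⟩
  ∑² k (λ a c → ∑² n (λ b d → f (a ++ b) (c ++ d))) ∎
  where open ≡-Reasoning

∑²-superadditive : ∀ {f} → (∀ a b c d → f a c + f b d ≤ f (a ++ b) (c ++ d)) →
                   ∀ k n → 4 ^ n * ∑² k f + 4 ^ k * ∑² n f ≤ ∑² (k + n) f
∑²-superadditive {f} f-superadditive k n = begin
  4 ^ n * ∑² k f + 4 ^ k * ∑² n f
    ≡⟨ cong₂ _+_ (∑²-distribˡ-* k (4 ^ n) f) (∑²-const k (∑² n f)) ⟨
  ∑² k (λ a c → 4 ^ n * f a c) + ∑² k (λ _ _ → ∑² n f)
    ≡⟨ ∑²-distrib-+ k _ _ ⟨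
  ∑² k (λ a c → 4 ^ n * f a c + ∑² n f)
    ≤⟨ ∑²-mono-≤ k concat-bound ⟩
  ∑² k (λ a c → ∑² n (λ b d → f (a ++ b) (c ++ d)))
    ≡⟨ ∑²-+ k n f ⟨
  ∑² (k + n) f ∎
  where
  open ≤-Reasoning
  concat-bound : ∀ a c → 4 ^ n * f a c + ∑² n f ≤ ∑² n (λ b d → f (a ++ b) (c ++ d))
  concat-bound a c = begin
    4 ^ n * f a c + ∑² n f                   ≡⟨ cong (_+ ∑² n f) (∑²-const n (f a c)) ⟨
    ∑² n (λ _ _ → f a c) + ∑² n f            ≡⟨ ∑²-distrib-+ n _ f ⟨
    ∑² n (λ b d → f a c + f b d)             ≤⟨ ∑²-mono-≤ n (λ b d → f-superadditive a b c d) ⟩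
    ∑² n (λ b d → f (a ++ b) (c ++ d))       ∎

longer : BinStr → BinStr → BinStr
longer u v = if length v ≤ᵇ length u then u else v

longer-preserves : ∀ (P : BinStr → Set) {u v} → P u → P v → P (longer u v)
longer-preserves P {u} {v} Pu Pv with length v ≤ᵇ length u
... | true  = Pu
... | false = Pv

-- The textbook LCS recursion: unlike LCS, which enumerates all subsequences, it is fast
-- enough to evaluate on all 4 ^ 7 pairs of strings of length 7.
commonSubseq : BinStr → BinStr → BinStr
commonSubseq []      t       = []
commonSubseq (_ ∷ _) []      = []
commonSubseq (x ∷ s) (y ∷ t) =
  if does (x ≟ᴮ y) then x ∷ commonSubseq s t
  else longer (commonSubseq (x ∷ s) t) (commonSubseq s (y ∷ t))

∷-common : ∀ {x u s t} → Common u s t → Common (x ∷ u) (x ∷ s) (x ∷ t)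
∷-common (u⊆s , u⊆t) = refl ∷ u⊆s , refl ∷ u⊆t

longer-common : ∀ {x y u v s t} → Common u (x ∷ s) t → Common v s (y ∷ t) →
                Common (longer u v) (x ∷ s) (y ∷ t)
longer-common {x} {y} {s = s} {t} (u⊆xs , u⊆t) (v⊆s , v⊆yt) =
  longer-preserves (λ w → Common w (x ∷ s) (y ∷ t)) (u⊆xs , y ∷ʳ u⊆t) (x ∷ʳ v⊆s , v⊆yt)

commonSubseq-common : ∀ s t → Common (commonSubseq s t) s t
commonSubseq-common []          t           = [] , minimum t
commonSubseq-common (x ∷ s)     []          = minimum (x ∷ s) , []
commonSubseq-common (false ∷ s) (false ∷ t) = ∷-common (commonSubseq-common s t)
commonSubseq-common (true ∷ s)  (true ∷ t)  = ∷-common (commonSubseq-common s t)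
commonSubseq-common (false ∷ s) (true ∷ t)  =
  longer-common (commonSubseq-common (false ∷ s) t) (commonSubseq-common s (true ∷ t))
commonSubseq-common (true ∷ s)  (false ∷ t) =
  longer-common (commonSubseq-common (true ∷ s) t) (commonSubseq-common s (false ∷ t))

∑²-commonSubseq≤totalLCS : ∀ n → ∑² n (λ s t → length (commonSubseq s t)) ≤ totalLCS n
∑²-commonSubseq≤totalLCS n =
  ∑²-mono-≤ n λ s t → length≤LCS (commonSubseq-common s t)

totalLCS-7 : 77356 ≤ totalLCS 7
totalLCS-7 = subst (_≤ totalLCS 7) ∑²-commonSubseq-7 (∑²-commonSubseq≤totalLCS 7)
  where
  ∑²-commonSubseq-7 : ∑² 7 (λ s t → length (commonSubseq s t)) ≡ 77356
  ∑²-commonSubseq-7 = refl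

-- With e n = T n / b ^ n the hypotheses say that e is superadditive and e k ≥ (p / q) k;
-- the conclusion is e n ≥ (p / q) (n − k), stated without division or subtraction.
superadditive⇒linear-lower-bound :
  ∀ b (T : ℕ → ℕ) → (∀ k n → b ^ n * T k + b ^ k * T n ≤ T (k + n)) →
  ∀ p q k .{{_ : NonZero k}} → p * k * b ^ k ≤ q * T k →
  ∀ n → p * n * b ^ n ≤ q * T n + p * k * b ^ n
superadditive⇒linear-lower-bound b T superadditive p q k base = <-rec Bound bound
  where
  Bound : ℕ → Set
  Bound n = p * n * b ^ n ≤ q * T n + p * k * b ^ n

  below-k : ∀ {n} → n ≤ k → Bound n
  below-k {n} n≤k = ≤-trans (*-monoˡ-≤ (b ^ n) (*-monoʳ-≤ p n≤k)) (m≤n+m _ _)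

  distribute : ∀ p k m x y → p * (k + m) * (x * y) ≡ p * k * x * y + x * (p * m * y)
  distribute = solve-∀

  collect : ∀ q p k x y Tk Tm →
            q * Tk * y + x * (q * Tm + p * k * y) ≡ q * (y * Tk + x * Tm) + p * k * (x * y)
  collect = solve-∀

  add-k : ∀ m → Bound m → Bound (k + m)
  add-k m bound-m = begin
    p * (k + m) * b ^ (k + m)
      ≡⟨ cong (p * (k + m) *_) (^-distribˡ-+-* b k m) ⟩
    p * (k + m) * (b ^ k * b ^ m)
      ≡⟨ distribute p k m (b ^ k) (b ^ m) ⟩
    p * k * b ^ k * b ^ m + b ^ k * (p * m * b ^ m)
      ≤⟨ +-mono-≤ (*-monoˡ-≤ (b ^ m) base) (*-monoʳ-≤ (b ^ k) bound-m) ⟩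
    q * T k * b ^ m + b ^ k * (q * T m + p * k * b ^ m)
      ≡⟨ collect q p k (b ^ k) (b ^ m) (T k) (T m) ⟩
    q * (b ^ m * T k + b ^ k * T m) + p * k * (b ^ k * b ^ m)
      ≡⟨ cong (λ x → q * (b ^ m * T k + b ^ k * T m) + p * k * x) (^-distribˡ-+-* b k m) ⟨
    q * (b ^ m * T k + b ^ k * T m) + p * k * b ^ (k + m)
      ≤⟨ +-monoˡ-≤ _ (*-monoʳ-≤ q (superadditive k m)) ⟩
    q * T (k + m) + p * k * b ^ (k + m) ∎
    where open ≤-Reasoning

  bound : ∀ n → (∀ {m} → m < n → Bound m) → Bound n
  bound n smaller with k ≤? n
  ... | no  k≰n = below-k (<⇒≤ (≰⇒> k≰n))
  ... | yes k≤n with m , refl ← m≤n⇒∃[o]m+o≡n k≤n = add-k m (smaller (m<n+m m (>-nonZero⁻¹ k)))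

deficit-bounded : ∀ n → deficit n ≤ 66666 * 7 * 4 ^ n
deficit-bounded n = m≤n+o⇒m∸n≤o (66666 * n * 4 ^ n) (100000 * totalLCS n)
  (superadditive⇒linear-lower-bound 4 totalLCS (∑²-superadditive LCS-++-superadditive)
                                    66666 100000 7 base n)
  where
  -- Stated for a variable t: unifying 100000 * ?t with 100000 * totalLCS 7 instead makes
  -- the type checker evaluate totalLCS 7 by brute force.
  scale : ∀ t → 77356 ≤ t → 66666 * 7 * 4 ^ 7 ≤ 100000 * t
  scale t 77356≤t = ≤-trans (≤ᵇ⇒≤ (66666 * 7 * 4 ^ 7) (100000 * 77356) _) (*-monoʳ-≤ 100000 77356≤t)

  base : 66666 * 7 * 4 ^ 7 ≤ 100000 * totalLCS 7
  base = scale (totalLCS 7) totalLCS-7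

theorem5p2 : ∃[ C ] ∃[ N ] ∀ n → N ≤ n →
    deficit n * deficit n ≤ C * n * ⌊log₂ n ⌋ * (100000 * 4 ^ n) * (100000 * 4 ^ n)
theorem5p2 = D * D , 2 , λ n 2≤n → begin
  deficit n * deficit n
    ≤⟨ *-mono-≤ (deficit-bounded n) (deficit-bounded n) ⟩
  D * 4 ^ n * (D * 4 ^ n)
    ≡⟨ square D (4 ^ n) ⟩
  D * D * 1 * 1 * 4 ^ n * 4 ^ n
    ≤⟨ *-mono-≤ (*-mono-≤ (*-mono-≤ (*-monoʳ-≤ (D * D) (<⇒≤ 2≤n)) (⌊log₂⌋-mono-≤ 2≤n))
                          (m≤n*m (4 ^ n) 100000))
                (m≤n*m (4 ^ n) 100000) ⟩
  D * D * n * ⌊log₂ n ⌋ * (100000 * 4 ^ n) * (100000 * 4 ^ n) ∎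
  where
  open ≤-Reasoning
  D : ℕ
  D = 66666 * 7
  square : ∀ d x → d * x * (d * x) ≡ d * d * 1 * 1 * x * x
  square = solve-∀
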